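{- Let $G$ be a connected graph of order $n\ge 2$. The following are equivalent: (1) $\overline{\operatorname{Z}}_-(G)=n-2$; (2) $\operatorname{Z_-IR}(G)=n-2$; (3) $V(G)$ can be partitioned as $V(G)=A\sqcup B\sqcup C$ where $A$ and $B$ are nonempty independent sets ($C$ may be empty) and $G=G[A]\vee G[B]\vee G[C]$, i.e., every vertex of $A$ is adjacent to every vertex of $B\cup C$ and every vertex of $B$ is adjacent to every vertex of $C$.
   Context: Graphs are finite, simple, undirected. Skew color change rule: any vertex $u$ (blue or white) can change a white vertex $w$ to blue if $w$ is the only white neighbor of $u$. A skew forcing set is a set $S$ such that starting with exactly $S$ blue and applying the rule until no change is possible colors all of $V(G)$ blue. $\overline{\operatorname{Z}}_-(G)$ is the maximum cardinality of a minimal (w.r.t. inclusion) skew forcing set. A skew fort is a nonempty $F\subseteq V(G)$ with $|N(v)\cap F|\ne 1$ for every $v\in V(G)$ ($N(v)$ the open neighborhood). $S\subseteq V(G)$ is a $\operatorname{Z}_-$Ir-set if every $u\in S$ has a skew fort $F$ with $S\cap F=\{u\}$; $\operatorname{Z_-IR}(G)$ is the maximum cardinality of a $\operatorname{Z}_-$Ir-set. -}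

module Defs where

open import Data.Nat using (ℕ; _≤_)
open import Data.Bool using (Bool; true; false)
open import Data.Fin using (Fin)
open import Data.Fin.Subset using (Subset; _∈_; _∉_; _⊂_; _∩_; _∪_; ∣_∣; ⁅_⁆; Nonempty)
open import Data.Vec using (tabulate)
open import Data.Product using (Σ; ∃; _×_)
open import Data.Sum using (_⊎_)
open import Relation.Binary.PropositionalEquality using (_≡_; _≢_)
open import Relation.Nullary using (¬_)

record Graph (n : ℕ) : Set where
  field
    adj    : Fin n → Fin n → Bool
    sym    : ∀ u v → adj u v ≡ adj v u
    irrefl : ∀ v → adj v v ≡ false
open Graph public

module _ {n : ℕ} (G : Graph n) where

  Adj : Fin n → Fin n → Set
  Adj u v = adj G u v ≡ true

  N : Fin n → Subset n
  N v = tabulate (adj G v)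

  data Reach : Fin n → Fin n → Set where
    here : ∀ {u} → Reach u u
    step : ∀ {u v w} → Adj u v → Reach v w → Reach u w

  Connected : Set
  Connected = ∀ u v → Reach u v

  -- Final blue set of the skew forcing process started from S:
  -- least set containing S closed under the skew color change rule
  -- (u forces w when w is the only vertex of N(u) not yet blue).
  data Blue (S : Subset n) : Fin n → Set where
    base  : ∀ {v} → v ∈ S → Blue S v
    force : ∀ (u w : Fin n) → Adj u w →
            (∀ x → Adj u x → x ≢ w → Blue S x) → Blue S w

  SkewForcingSet : Subset n → Set
  SkewForcingSet S = ∀ v → Blue S v

  MinimalSkewForcingSet : Subset n → Set
  MinimalSkewForcingSet S =
    SkewForcingSet S × (∀ T → T ⊂ S → ¬ SkewForcingSet T)

  ZbarMinus≡ : ℕ → Set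
  ZbarMinus≡ k =
    (Σ (Subset n) λ S → MinimalSkewForcingSet S × ∣ S ∣ ≡ k) ×
    (∀ S → MinimalSkewForcingSet S → ∣ S ∣ ≤ k)

  SkewFort : Subset n → Set
  SkewFort F = Nonempty F × (∀ v → ∣ N v ∩ F ∣ ≢ 1)

  ZIrSet : Subset n → Set
  ZIrSet S = ∀ u → u ∈ S → Σ (Subset n) λ F → SkewFort F × (S ∩ F ≡ ⁅ u ⁆)

  ZIR≡ : ℕ → Set
  ZIR≡ k =
    (Σ (Subset n) λ S → ZIrSet S × ∣ S ∣ ≡ k) ×
    (∀ S → ZIrSet S → ∣ S ∣ ≤ k)

  Independent : Subset n → Set
  Independent A = ∀ u v → u ∈ A → v ∈ A → ¬ Adj u v

  JoinPartition : Set
  JoinPartition =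
    Σ (Subset n) λ A → Σ (Subset n) λ B → Σ (Subset n) λ C →
      (∀ v → v ∈ A ⊎ v ∈ B ⊎ v ∈ C) ×
      (∀ v → v ∈ A → v ∉ B) × (∀ v → v ∈ A → v ∉ C) × (∀ v → v ∈ B → v ∉ C) ×
      Nonempty A × Nonempty B × Independent A × Independent B ×
      (∀ a x → a ∈ A → x ∈ B ∪ C → Adj a x) ×
      (∀ b c → b ∈ B → c ∈ C → Adj b c)

module Submission where

-- Every vertex u of a Z₋Ir-set S has a fort meeting S only in u, and a fort disjoint from the
-- initial blue set never turns blue; so a skew forcing Z₋Ir-set is a minimal skew forcing set.
-- Conversely, if S is minimal and u ∈ S, the vertices left white by S - u form such a fort;
-- so minimal skew forcing sets are Z₋Ir-sets.  When G has no isolated vertex, the fort of a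
-- neighbour v ∈ S of x shows that no Z₋Ir-set contains V ∖ {x}, so |S| ≤ n - 2.  If S misses
-- exactly x and y, each fort F_u lies in {u, x, y}; this forces x ~ y and makes every vertex
-- non-adjacent to x (to y) a twin of x (of y), which yields the join partition
-- A = V ∖ N(x), B = V ∖ N(y), C = N(x) ∩ N(y).  Conversely, for a join partition with x ∈ A,
-- y ∈ B, the set V ∖ {x, y} is skew forcing (x and y force each other) and {u, x}, {u, y},
-- {u, x, y} are forts for u in A, B, C respectively.

open import Defs hiding (sym)
open import Data.Bool as Bool using (Bool; true)
open import Data.Empty using (⊥-elim)
open import Data.Fin using (Fin; zero; suc; _≟_; punchIn)
open import Data.Fin.Properties using (any?; all?; punchInᵢ≢i)
open import Data.Fin.Subset
  using (Subset; inside; outside; _∈_; _∉_; _⊆_; _⊂_; _⊃_; _∩_; _∪_; _-_; ∁; ⊤; ⁅_⁆; ∣_∣; Nonempty)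
open import Data.Fin.Subset.Properties
  using ( _∈?_; nonempty?; Empty-unique; ∣⊥∣≡0; ∈⊤; ∣⊤∣≡n; x∈⁅x⁆; x∈⁅y⁆⇒x≡y; ∣⁅x⁆∣≡1; ⊆-antisym
        ; p⊆q⇒∣p∣≤∣q∣; p⊂q⇒∣p∣<∣q∣; x∈∁p⇒x∉p; x∉p⇒x∈∁p; x∈p∩q⁺; x∈p∩q⁻; p⊆p∪q; x∈p∪q⁺; x∈p∪q⁻
        ; p─⊥≡p; p─q⊆p; x∈p∧x≢y⇒x∈p-y; x∈p⇒p-x⊂p; x∈p⇒∣p-x∣<∣p∣)
open import Data.Fin.Subset.Induction using (⊃-wellFounded)
open import Data.Nat using (ℕ; zero; suc; _+_; _≤_; _<_; _∸_; s≤s; s≤s⁻¹)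
open import Data.Nat.Properties using (suc-injective; 1+n≢0; ≤-reflexive; ≤-trans; <⇒≱; n≮0)
open import Data.Product as Product using (∃; ∃₂; ∃-syntax; _×_; _,_; proj₁; proj₂; uncurry)
open import Data.Sum as Sum using (_⊎_; inj₁; inj₂; map₁; map₂; swap)
open import Data.Vec using (_∷_; here; there; tabulate)
open import Data.Vec.Properties using (lookup∘tabulate; []=⇒lookup; lookup⇒[]=)
open import Function using (_∘_; id)
open import Function.Bundles using (_⇔_; mk⇔; Equivalence)
open import Induction.WellFounded using (Acc; acc)
open import Level using (0ℓ)
open import Relation.Binary.PropositionalEquality using (_≡_; _≢_; refl; sym; trans; cong; subst)
open import Relation.Nullary using (¬_; Dec; yes; no; does; ¬?; _×-dec_; _→-dec_)
open import Relation.Nullary.Decidable using (map′; dec-true; decidable-stable)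
open import Relation.Unary using (Pred; Decidable)

open Equivalence using (to; from)

x∈p⇒suc∣p-x∣≡∣p∣ : ∀ {n} {p : Subset n} {x} → x ∈ p → suc ∣ p - x ∣ ≡ ∣ p ∣
x∈p⇒suc∣p-x∣≡∣p∣ {p = inside ∷ p} here = cong (suc ∘ ∣_∣) (p─⊥≡p p)
x∈p⇒suc∣p-x∣≡∣p∣ {p = inside ∷ p} (there x∈p) = cong suc (x∈p⇒suc∣p-x∣≡∣p∣ x∈p)
x∈p⇒suc∣p-x∣≡∣p∣ {p = outside ∷ p} (there x∈p) = x∈p⇒suc∣p-x∣≡∣p∣ x∈p

x∉p-x : ∀ {n} {p : Subset n} {x} → x ∉ p - x
x∉p-x {p = _ ∷ _} {x = zero} ()
x∉p-x {p = _ ∷ _} {x = suc x} (there x∈p-x) = x∉p-x x∈p-x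

∣p∣≢0⇒Nonempty : ∀ {n} {p : Subset n} → ∣ p ∣ ≢ 0 → Nonempty p
∣p∣≢0⇒Nonempty {n = n} {p = p} ∣p∣≢0 with nonempty? p
... | yes nonempty = nonempty
... | no empty = ⊥-elim (∣p∣≢0 (trans (cong ∣_∣ (Empty-unique empty)) (∣⊥∣≡0 n)))

∣p∣≡0⇒x∉p : ∀ {n} {p : Subset n} {x} → ∣ p ∣ ≡ 0 → x ∉ p
∣p∣≡0⇒x∉p {p = p} {x = x} ∣p∣≡0 x∈p = n≮0 (subst (∣ p - x ∣ <_) ∣p∣≡0 (x∈p⇒∣p-x∣<∣p∣ x∈p))

infix 4 _∈!_
_∈!_ : ∀ {n} → Fin n → Subset n → Set
x ∈! p = x ∈ p × (∀ {z} → z ∈ p → z ≡ x)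

p≡⁅x⁆⇔x∈!p : ∀ {n} {p : Subset n} {x} → p ≡ ⁅ x ⁆ ⇔ x ∈! p
p≡⁅x⁆⇔x∈!p {p = p} {x = x} = mk⇔ (λ { refl → x∈⁅x⁆ x , x∈⁅y⁆⇒x≡y x }) (uncurry singleton)
  where
  singleton : x ∈ p → (∀ {z} → z ∈ p → z ≡ x) → p ≡ ⁅ x ⁆
  singleton x∈p only-x = ⊆-antisym
    (λ z∈p → subst (_∈ ⁅ x ⁆) (sym (only-x z∈p)) (x∈⁅x⁆ x))
    (λ z∈⁅x⁆ → subst (_∈ p) (sym (x∈⁅y⁆⇒x≡y x z∈⁅x⁆)) x∈p)

∣p∣≡1⇔∃∈! : ∀ {n} {p : Subset n} → ∣ p ∣ ≡ 1 ⇔ (∃[ x ] x ∈! p)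
∣p∣≡1⇔∃∈! {p = p} = mk⇔ unique-member
  (λ (x , x-only) → trans (cong ∣_∣ (from p≡⁅x⁆⇔x∈!p x-only)) (∣⁅x⁆∣≡1 x))
  where
  unique-member : ∣ p ∣ ≡ 1 → ∃[ x ] x ∈! p
  unique-member ∣p∣≡1 with ∣p∣≢0⇒Nonempty (1+n≢0 ∘ trans (sym ∣p∣≡1))
  ... | x , x∈p = x , x∈p , only-x
    where
    ∣p-x∣≡0 : ∣ p - x ∣ ≡ 0
    ∣p-x∣≡0 = suc-injective (trans (x∈p⇒suc∣p-x∣≡∣p∣ x∈p) ∣p∣≡1)
    only-x : ∀ {z} → z ∈ p → z ≡ x
    only-x {z} z∈p with z ≟ x
    ... | yes z≡x = z≡x
    ... | no z≢x = ⊥-elim (∣p∣≡0⇒x∉p ∣p-x∣≡0 (x∈p∧x≢y⇒x∈p-y z∈p z≢x))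

p⊆q∧∣q∣≤∣p∣⇒q⊆p : ∀ {n} {p q : Subset n} → p ⊆ q → ∣ q ∣ ≤ ∣ p ∣ → q ⊆ p
p⊆q∧∣q∣≤∣p∣⇒q⊆p {p = p} p⊆q ∣q∣≤∣p∣ {x} x∈q with x ∈? p
... | yes x∈p = x∈p
... | no x∉p = ⊥-elim (<⇒≱ (p⊂q⇒∣p∣<∣q∣ (p⊆q , x , x∈q , x∉p)) ∣q∣≤∣p∣)

∈⊤-x-y⁺ : ∀ {n} {x y z : Fin n} → z ≢ x → z ≢ y → z ∈ ⊤ - x - y
∈⊤-x-y⁺ z≢x z≢y = x∈p∧x≢y⇒x∈p-y (x∈p∧x≢y⇒x∈p-y ∈⊤ z≢x) z≢y

∈⊤-x-y⁻ : ∀ {n} {x y z : Fin n} → z ∈ ⊤ - x - y → z ≢ x × z ≢ y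
∈⊤-x-y⁻ {x = x} {y = y} z∈ =
  (λ { refl → x∉p-x (p─q⊆p (⊤ - x) ⁅ y ⁆ z∈) }) , (λ { refl → x∉p-x z∈ })

∣⊤-x-y∣ : ∀ {n} {x y : Fin n} → y ≢ x → 2 + ∣ ⊤ - x - y ∣ ≡ n
∣⊤-x-y∣ {n} {x} {y} y≢x =
  trans (cong suc (x∈p⇒suc∣p-x∣≡∣p∣ {p = ⊤ {n} - x} (x∈p∧x≢y⇒x∈p-y ∈⊤ y≢x)))
        (trans (x∈p⇒suc∣p-x∣≡∣p∣ {p = ⊤ {n}} ∈⊤) (∣⊤∣≡n n))

⊆⊤-x-y : ∀ {n} {p : Subset n} {x y} → x ∉ p → y ∉ p → p ⊆ ⊤ - x - y
⊆⊤-x-y x∉p y∉p z∈p = ∈⊤-x-y⁺ (λ { refl → x∉p z∈p }) (λ { refl → y∉p z∈p })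

two-outside⇒size : ∀ {n} {p : Subset n} {x y} → x ≢ y → x ∉ p → y ∉ p → 2 + ∣ p ∣ ≤ n
two-outside⇒size x≢y x∉p y∉p =
  ≤-trans (s≤s (s≤s (p⊆q⇒∣p∣≤∣q∣ (⊆⊤-x-y x∉p y∉p)))) (≤-reflexive (∣⊤-x-y∣ (x≢y ∘ sym)))

two-outside⇒cover : ∀ {n} {p : Subset n} {x y} → x ≢ y → x ∉ p → y ∉ p → 2 + ∣ p ∣ ≡ n →
                    ∀ z → z ∈ p ⊎ z ≡ x ⊎ z ≡ y
two-outside⇒cover {p = p} {x = x} {y = y} x≢y x∉p y∉p size z with z ≟ x | z ≟ y
... | yes z≡x | _ = inj₂ (inj₁ z≡x)
... | no _ | yes z≡y = inj₂ (inj₂ z≡y)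
... | no z≢x | no z≢y = inj₁ (⊤-x-y⊆p (∈⊤-x-y⁺ z≢x z≢y))
  where
  ⊤-x-y⊆p : ⊤ - x - y ⊆ p
  ⊤-x-y⊆p = p⊆q∧∣q∣≤∣p∣⇒q⊆p (⊆⊤-x-y x∉p y∉p)
    (≤-reflexive (suc-injective (suc-injective (trans (∣⊤-x-y∣ (x≢y ∘ sym)) (sym size)))))

∈⁅x⁆∪⁅y⁆⁻ : ∀ {n} {x y z : Fin n} → z ∈ ⁅ x ⁆ ∪ ⁅ y ⁆ → z ≡ x ⊎ z ≡ y
∈⁅x⁆∪⁅y⁆⁻ {x = x} {y} = Sum.map (x∈⁅y⁆⇒x≡y x) (x∈⁅y⁆⇒x≡y y) ∘ x∈p∪q⁻ ⁅ x ⁆ ⁅ y ⁆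

x∈tabulate⇔ : ∀ {n} {f : Fin n → Bool} {x} → x ∈ tabulate f ⇔ f x ≡ true
x∈tabulate⇔ {f = f} {x} = mk⇔
  (λ x∈ → trans (sym (lookup∘tabulate f x)) ([]=⇒lookup x∈))
  (λ fx → lookup⇒[]= x _ (trans (lookup∘tabulate f x) fx))

toSubset : ∀ {n} {P : Pred (Fin n) 0ℓ} → Decidable P → Subset n
toSubset P? = tabulate (does ∘ P?)

x∈toSubset⇔ : ∀ {n} {P : Pred (Fin n) 0ℓ} (P? : Decidable P) {x} → x ∈ toSubset P? ⇔ P x
x∈toSubset⇔ P? {x} = mk⇔
  (λ x∈ → yes⇒ (P? x) (to x∈tabulate⇔ x∈))
  (λ Px → from x∈tabulate⇔ (dec-true (P? x) Px))
  where
  yes⇒ : ∀ {A : Set} (A? : Dec A) → does A? ≡ true → A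
  yes⇒ (yes a) _ = a

module _ {n} (G : Graph n) where

  Adj-sym : ∀ {u v} → Adj G u v → Adj G v u
  Adj-sym {u} {v} u~v = trans (Graph.sym G v u) u~v

  Adj-irrefl : ∀ {v} → ¬ Adj G v v
  Adj-irrefl {v} v~v with trans (sym v~v) (irrefl G v)
  ... | ()

  adj? : ∀ u v → Dec (Adj G u v)
  adj? u v = adj G u v Bool.≟ true

  walk⇒edge : ∀ {u v} → Reach G u v → u ≢ v → ∃ (Adj G u)
  walk⇒edge here u≢u = ⊥-elim (u≢u refl)
  walk⇒edge (step u~w _) _ = _ , u~w

  ∈∁N⁺ : ∀ {t u} → ¬ Adj G t u → u ∈ ∁ (N G t)
  ∈∁N⁺ t≁u = x∉p⇒x∈∁p (t≁u ∘ to x∈tabulate⇔)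

  ∈∁N⁻ : ∀ {t u} → u ∈ ∁ (N G t) → ¬ Adj G t u
  ∈∁N⁻ u∈ = x∈∁p⇒x∉p u∈ ∘ from x∈tabulate⇔

  Twins : Fin n → Fin n → Set
  Twins u v = ∀ w → Adj G w u ⇔ Adj G w v

  UniqueNeighbourIn : Subset n → Fin n → Fin n → Set
  UniqueNeighbourIn F v a = Adj G v a × a ∈ F × (∀ {b} → Adj G v b → b ∈ F → b ≡ a)

  NoUniqueNeighbour : Subset n → Set
  NoUniqueNeighbour F = ∀ v → ∣ N G v ∩ F ∣ ≢ 1

  ∣N∩F∣≡1⇔ : ∀ {F v} → ∣ N G v ∩ F ∣ ≡ 1 ⇔ ∃ (UniqueNeighbourIn F v)
  ∣N∩F∣≡1⇔ {F} {v} = mk⇔ (unique ∘ to ∣p∣≡1⇔∃∈!) (from ∣p∣≡1⇔∃∈! ∘ unique⁻)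
    where
    ∈N∩F⁺ : ∀ {b} → Adj G v b → b ∈ F → b ∈ N G v ∩ F
    ∈N∩F⁺ v~b b∈F = x∈p∩q⁺ (from x∈tabulate⇔ v~b , b∈F)
    ∈N∩F⁻ : ∀ {b} → b ∈ N G v ∩ F → Adj G v b × b ∈ F
    ∈N∩F⁻ = Product.map₁ (to x∈tabulate⇔) ∘ x∈p∩q⁻ _ _
    unique : ∃[ a ] a ∈! N G v ∩ F → ∃ (UniqueNeighbourIn F v)
    unique (a , a∈ , only-a) =
      a , proj₁ (∈N∩F⁻ a∈) , proj₂ (∈N∩F⁻ a∈) , λ v~b b∈F → only-a (∈N∩F⁺ v~b b∈F)
    unique⁻ : ∃ (UniqueNeighbourIn F v) → ∃[ a ] a ∈! N G v ∩ F
    unique⁻ (a , v~a , a∈F , only-a) = a , ∈N∩F⁺ v~a a∈F , uncurry only-a ∘ ∈N∩F⁻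

  second-neighbour : ∀ {F v a} → NoUniqueNeighbour F → Adj G v a → a ∈ F →
                     ∃[ b ] b ≢ a × b ∈ F × Adj G v b
  second-neighbour {F} {v} {a} fort v~a a∈F with any? (λ b → ¬? (b ≟ a) ×-dec b ∈? F ×-dec adj? v b)
  ... | yes found = found
  ... | no none = ⊥-elim (fort v (from ∣N∩F∣≡1⇔ (a , v~a , a∈F , only-a)))
    where
    only-a : ∀ {b} → Adj G v b → b ∈ F → b ≡ a
    only-a {b} v~b b∈F = decidable-stable (b ≟ a) (λ b≢a → none (b , b≢a , b∈F , v~b))

  NoneOrTwoNeighboursIn : Subset n → Fin n → Set
  NoneOrTwoNeighboursIn F v =
    (∀ {a} → a ∈ F → ¬ Adj G v a) ⊎ ∃₂ (λ b c → b ≢ c × b ∈ F × c ∈ F × Adj G v b × Adj G v c)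

  none-or-two⇒NoUniqueNeighbour : ∀ {F} → (∀ v → NoneOrTwoNeighboursIn F v) → NoUniqueNeighbour F
  none-or-two⇒NoUniqueNeighbour none-or-two v ∣N∩F∣≡1 with to ∣N∩F∣≡1⇔ ∣N∩F∣≡1 | none-or-two v
  ... | _ , v~a , a∈F , _ | inj₁ none = none a∈F v~a
  ... | _ , _ , _ , only-a | inj₂ (_ , _ , b≢c , b∈F , c∈F , v~b , v~c) =
    b≢c (trans (only-a v~b b∈F) (sym (only-a v~c c∈F)))

  Blue-trans : ∀ {S T} → (∀ {v} → v ∈ T → Blue G S v) → ∀ {v} → Blue G T v → Blue G S v
  Blue-trans T⊆Blue (base v∈T) = T⊆Blue v∈T
  Blue-trans T⊆Blue (force u w u~w others) =
    force u w u~w (λ x u~x x≢w → Blue-trans T⊆Blue (others x u~x x≢w))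

  fort-stays-white : ∀ {F T w} → NoUniqueNeighbour F → (∀ {z} → z ∈ F → z ∉ T) → Blue G T w → w ∉ F
  fort-stays-white _ F∩T≡∅ (base w∈T) w∈F = F∩T≡∅ w∈F w∈T
  fort-stays-white fort F∩T≡∅ (force u w u~w others) w∈F with second-neighbour fort u~w w∈F
  ... | b , b≢w , b∈F , u~b = fort-stays-white fort F∩T≡∅ (others b u~b b≢w) b∈F

  ForcingStep : Subset n → Fin n → Fin n → Set
  ForcingStep S u w = Adj G u w × (∀ x → Adj G u x → x ≢ w → x ∈ S) × w ∉ S

  forcingStep? : ∀ S u w → Dec (ForcingStep S u w)
  forcingStep? S u w =
    adj? u w ×-dec all? (λ x → adj? u x →-dec ¬? (x ≟ w) →-dec x ∈? S) ×-dec ¬? (w ∈? S)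

  stalled⇒Blue⊆ : ∀ {S v} → (∀ u w → ¬ ForcingStep S u w) → Blue G S v → v ∈ S
  stalled⇒Blue⊆ _ (base v∈S) = v∈S
  stalled⇒Blue⊆ {S} stalled (force u w u~w others) =
    decidable-stable (w ∈? S)
      (λ w∉S → stalled u w (u~w , (λ x u~x x≢w → stalled⇒Blue⊆ stalled (others x u~x x≢w)) , w∉S))

  -- Each forcing step enlarges the blue set, so the recursion is on _⊃_.
  blue? : ∀ S → Acc _⊃_ S → ∀ v → Dec (Blue G S v)
  blue? S (acc larger) v with any? (λ u → any? (forcingStep? S u))
  ... | no stalled = map′ base (stalled⇒Blue⊆ (λ u w step → stalled (u , w , step))) (v ∈? S)
  ... | yes (u , w , u~w , others , w∉S) =
    map′ (Blue-trans S∪w⊆Blue) (Blue-trans (base ∘ p⊆p∪q ⁅ w ⁆)) (blue? (S ∪ ⁅ w ⁆) (larger S⊂S∪w) v)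
    where
    S⊂S∪w : S ⊂ S ∪ ⁅ w ⁆
    S⊂S∪w = p⊆p∪q ⁅ w ⁆ , w , x∈p∪q⁺ (inj₂ (x∈⁅x⁆ w)) , w∉S
    S∪w⊆Blue : ∀ {z} → z ∈ S ∪ ⁅ w ⁆ → Blue G S z
    S∪w⊆Blue {z} z∈ with x∈p∪q⁻ S ⁅ w ⁆ z∈
    ... | inj₁ z∈S = base z∈S
    ... | inj₂ z∈⁅w⁆ rewrite x∈⁅y⁆⇒x≡y w z∈⁅w⁆ = force u w u~w (λ x u~x x≢w → base (others x u~x x≢w))

  SeparatingFort : Subset n → Fin n → Subset n → Set
  SeparatingFort S u F = NoUniqueNeighbour F × u ∈ F × (∀ {z} → z ∈ S → z ∈ F → z ≡ u)

  ZIrSet⇔ : ∀ {S} → ZIrSet G S ⇔ (∀ {u} → u ∈ S → ∃ (SeparatingFort S u))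
  ZIrSet⇔ {S} = mk⇔ separating-forts from-separating-forts
    where
    separating-forts : ZIrSet G S → ∀ {u} → u ∈ S → ∃ (SeparatingFort S u)
    separating-forts ir u∈S with ir _ u∈S
    ... | F , (_ , fort) , S∩F≡⁅u⁆ with to p≡⁅x⁆⇔x∈!p S∩F≡⁅u⁆
    ... | u∈S∩F , only-u =
      F , fort , proj₂ (x∈p∩q⁻ S F u∈S∩F) , λ z∈S z∈F → only-u (x∈p∩q⁺ (z∈S , z∈F))
    from-separating-forts : (∀ {u} → u ∈ S → ∃ (SeparatingFort S u)) → ZIrSet G S
    from-separating-forts separating u u∈S with separating u∈S
    ... | F , fort , u∈F , only-u =
      F , ((u , u∈F) , fort) , from p≡⁅x⁆⇔x∈!p (x∈p∩q⁺ (u∈S , u∈F) , uncurry only-u ∘ x∈p∩q⁻ S F)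

  -- The fort for u is the set left white when the forcing process starts from S - u.
  minimal⇒separating-fort : ∀ {S u} → MinimalSkewForcingSet G S → u ∈ S → ∃ (SeparatingFort S u)
  minimal⇒separating-fort {S} {u} (forcing , minimal) u∈S = White , fort , u∈White , only-u
    where
    blue-T? : ∀ v → Dec (Blue G (S - u) v)
    blue-T? = blue? (S - u) (⊃-wellFounded (S - u))
    White : Subset n
    White = toSubset (¬? ∘ blue-T?)
    u∈White : u ∈ White
    u∈White = from (x∈toSubset⇔ (¬? ∘ blue-T?)) λ u-blue →
      minimal (S - u) (x∈p⇒p-x⊂p u∈S) λ v → Blue-trans (S⊆Blue u-blue) (forcing v)
      where
      S⊆Blue : Blue G (S - u) u → ∀ {z} → z ∈ S → Blue G (S - u) z
      S⊆Blue u-blue {z} z∈S with z ≟ u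
      ... | yes refl = u-blue
      ... | no z≢u = base (x∈p∧x≢y⇒x∈p-y z∈S z≢u)
    fort : NoUniqueNeighbour White
    fort v ∣N∩W∣≡1 with to ∣N∩F∣≡1⇔ ∣N∩W∣≡1
    ... | a , v~a , a∈W , only-a = to (x∈toSubset⇔ (¬? ∘ blue-T?)) a∈W (force v a v~a others-blue)
      where
      others-blue : ∀ x → Adj G v x → x ≢ a → Blue G (S - u) x
      others-blue x v~x x≢a = decidable-stable (blue-T? x)
        (λ x-white → x≢a (only-a v~x (from (x∈toSubset⇔ (¬? ∘ blue-T?)) x-white)))
    only-u : ∀ {z} → z ∈ S → z ∈ White → z ≡ u
    only-u {z} z∈S z∈W = decidable-stable (z ≟ u)
      (λ z≢u → to (x∈toSubset⇔ (¬? ∘ blue-T?)) z∈W (base (x∈p∧x≢y⇒x∈p-y z∈S z≢u)))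

  minimal⇒ZIrSet : ∀ {S} → MinimalSkewForcingSet G S → ZIrSet G S
  minimal⇒ZIrSet minimal = from ZIrSet⇔ (minimal⇒separating-fort minimal)

  ZIrSet⇒no-forcing-proper-subset : ∀ {S} → ZIrSet G S → ∀ T → T ⊂ S → ¬ SkewForcingSet G T
  ZIrSet⇒no-forcing-proper-subset ir T (T⊆S , u , u∈S , u∉T) forcing
    with to ZIrSet⇔ ir u∈S
  ... | F , fort , u∈F , only-u = fort-stays-white fort F∩T≡∅ (forcing u) u∈F
    where
    F∩T≡∅ : ∀ {z} → z ∈ F → z ∉ T
    F∩T≡∅ z∈F z∈T with only-u (T⊆S z∈T) z∈F
    ... | refl = u∉T z∈T

  forcing-ZIrSet⇒minimal : ∀ {S} → SkewForcingSet G S → ZIrSet G S → MinimalSkewForcingSet G S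
  forcing-ZIrSet⇒minimal forcing ir = forcing , ZIrSet⇒no-forcing-proper-subset ir

  twins⇒NoUniqueNeighbour : ∀ {u t} → u ≢ t → Twins u t → NoUniqueNeighbour (⁅ u ⁆ ∪ ⁅ t ⁆)
  twins⇒NoUniqueNeighbour {u} {t} u≢t twins = none-or-two⇒NoUniqueNeighbour none-or-two
    where
    none-or-two : ∀ v → NoneOrTwoNeighboursIn (⁅ u ⁆ ∪ ⁅ t ⁆) v
    none-or-two v with adj? v t
    ... | yes v~t = inj₂ (u , t , u≢t , x∈p∪q⁺ (inj₁ (x∈⁅x⁆ u)) , x∈p∪q⁺ (inj₂ (x∈⁅x⁆ t)) ,
                          from (twins v) v~t , v~t)
    ... | no v≁t = inj₁ λ a∈ v~a → v≁t (adj-t (∈⁅x⁆∪⁅y⁆⁻ a∈) v~a)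
      where
      adj-t : ∀ {a} → a ≡ u ⊎ a ≡ t → Adj G v a → Adj G v t
      adj-t (inj₁ refl) = to (twins v)
      adj-t (inj₂ refl) = id

  edge-cover⇒forcing : ∀ {S x y} → Adj G x y → (∀ z → z ∈ S ⊎ z ≡ x ⊎ z ≡ y) → SkewForcingSet G S
  edge-cover⇒forcing {S} {x} {y} x~y cover v = blue (cover v)
    where
    in-S : ∀ z → z ≢ x → z ≢ y → z ∈ S
    in-S z z≢x z≢y with cover z
    ... | inj₁ z∈S = z∈S
    ... | inj₂ (inj₁ z≡x) = ⊥-elim (z≢x z≡x)
    ... | inj₂ (inj₂ z≡y) = ⊥-elim (z≢y z≡y)
    blue : ∀ {v} → v ∈ S ⊎ v ≡ x ⊎ v ≡ y → Blue G S v
    blue (inj₁ v∈S) = base v∈S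
    blue (inj₂ (inj₁ refl)) =
      force y x (Adj-sym x~y) (λ z y~z z≢x → base (in-S z z≢x λ { refl → Adj-irrefl y~z }))
    blue (inj₂ (inj₂ refl)) =
      force x y x~y (λ z x~z z≢y → base (in-S z (λ { refl → Adj-irrefl x~z }) z≢y))

  module _ (no-isolated : ∀ x → ∃ (Adj G x)) where

    ZIrSet⇒¬almost-full : ∀ {S} → ZIrSet G S → ∀ x → ¬ (∀ y → y ≢ x → y ∈ S)
    ZIrSet⇒¬almost-full ir x in-S with no-isolated x
    ... | v , x~v with to ZIrSet⇔ ir (in-S v λ { refl → Adj-irrefl x~v })
    ... | F , fort , v∈F , only-v with second-neighbour fort x~v v∈F
    ... | b , b≢v , b∈F , x~b = b≢v (only-v (in-S b λ { refl → Adj-irrefl x~b }) b∈F)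

    ZIrSet⇒outside : ∀ {S} → ZIrSet G S → ∀ x → ∃[ y ] y ≢ x × y ∉ S
    ZIrSet⇒outside {S} ir x with any? (λ y → ¬? (y ≟ x) ×-dec ¬? (y ∈? S))
    ... | yes found = found
    ... | no none = ⊥-elim (ZIrSet⇒¬almost-full ir x λ y y≢x →
                      decidable-stable (y ∈? S) (λ y∉S → none (y , y≢x , y∉S)))

    ZIrSet⇒two-outside : ∀ {S} → ZIrSet G S → Fin n → ∃₂ λ x y → x ≢ y × x ∉ S × y ∉ S
    ZIrSet⇒two-outside ir v with ZIrSet⇒outside ir v
    ... | x , _ , x∉S with ZIrSet⇒outside ir x
    ... | y , y≢x , y∉S = x , y , y≢x ∘ sym , x∉S , y∉S

    module TwoOutside {S} (ir : ZIrSet G S) {x y} (cover : ∀ z → z ∈ S ⊎ z ≡ x ⊎ z ≡ y) where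

      fort-in-triple : ∀ {u} → u ∈ S →
        ∃[ F ] NoUniqueNeighbour F × u ∈ F × (∀ {z} → z ∈ F → z ≡ u ⊎ z ≡ x ⊎ z ≡ y)
      fort-in-triple u∈S with to ZIrSet⇔ ir u∈S
      ... | F , fort , u∈F , only-u =
        F , fort , u∈F , λ {z} z∈F → map₁ (λ z∈S → only-u z∈S z∈F) (cover z)

      adj-x-y : Adj G x y
      adj-x-y with no-isolated x
      ... | w , x~w with cover w
      ... | inj₂ (inj₁ refl) = ⊥-elim (Adj-irrefl x~w)
      ... | inj₂ (inj₂ refl) = x~w
      ... | inj₁ w∈S with fort-in-triple w∈S
      ... | F , fort , w∈F , F⊆wxy with second-neighbour fort x~w w∈F
      ... | b , b≢w , b∈F , x~b with F⊆wxy b∈F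
      ... | inj₁ refl = ⊥-elim (b≢w refl)
      ... | inj₂ (inj₁ refl) = ⊥-elim (Adj-irrefl x~b)
      ... | inj₂ (inj₂ refl) = x~b

      -- The fort of u turns out to be {u, x}, which forces u and x to have the same neighbours.
      non-adjacent⇒twins : ∀ {u} → ¬ Adj G x u → Twins u x
      non-adjacent⇒twins {u} x≁u with cover u
      ... | inj₂ (inj₁ refl) = λ _ → mk⇔ id id
      ... | inj₂ (inj₂ refl) = ⊥-elim (x≁u adj-x-y)
      ... | inj₁ u∈S with fort-in-triple u∈S
      ... | F , fort , u∈F , F⊆uxy = λ w → mk⇔ (proj₂ ∘ partner-of-u) partner-of-x
        where
        y∉F : y ∉ F
        y∉F y∈F with second-neighbour fort adj-x-y y∈F
        ... | b , b≢y , b∈F , x~b with F⊆uxy b∈F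
        ... | inj₁ refl = x≁u x~b
        ... | inj₂ (inj₁ refl) = Adj-irrefl x~b
        ... | inj₂ (inj₂ refl) = b≢y refl
        partner-of-u : ∀ {w} → Adj G w u → x ∈ F × Adj G w x
        partner-of-u w~u with second-neighbour fort w~u u∈F
        ... | b , b≢u , b∈F , w~b with F⊆uxy b∈F
        ... | inj₁ refl = ⊥-elim (b≢u refl)
        ... | inj₂ (inj₁ refl) = b∈F , w~b
        ... | inj₂ (inj₂ refl) = ⊥-elim (y∉F b∈F)
        x∈F : x ∈ F
        x∈F = proj₁ (partner-of-u (Adj-sym (proj₂ (no-isolated u))))
        partner-of-x : ∀ {w} → Adj G w x → Adj G w u
        partner-of-x w~x with second-neighbour fort w~x x∈F
        ... | b , b≢x , b∈F , w~b with F⊆uxy b∈F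
        ... | inj₁ refl = w~b
        ... | inj₂ (inj₁ refl) = ⊥-elim (b≢x refl)
        ... | inj₂ (inj₂ refl) = ⊥-elim (y∉F b∈F)

    module JoinOfTwoOutside {S} (ir : ZIrSet G S) {x y} (cover : ∀ z → z ∈ S ⊎ z ≡ x ⊎ z ≡ y) where
      open TwoOutside ir cover using (adj-x-y; non-adjacent⇒twins)
      open TwoOutside ir (map₂ swap ∘ cover)
        using () renaming (non-adjacent⇒twins to non-adjacent-y⇒twins)

      A B C : Subset n
      A = ∁ (N G x)
      B = ∁ (N G y)
      C = N G x ∩ N G y

      ∈C⁻ : ∀ {u} → u ∈ C → Adj G x u × Adj G y u
      ∈C⁻ u∈C = Product.map (to x∈tabulate⇔) (to x∈tabulate⇔) (x∈p∩q⁻ _ _ u∈C)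

      twins-x : ∀ {u} → u ∈ A → Twins u x
      twins-x = non-adjacent⇒twins ∘ ∈∁N⁻

      twins-y : ∀ {u} → u ∈ B → Twins u y
      twins-y = non-adjacent-y⇒twins ∘ ∈∁N⁻

      partition : ∀ v → v ∈ A ⊎ v ∈ B ⊎ v ∈ C
      partition v with adj? x v | adj? y v
      ... | no x≁v | _ = inj₁ (∈∁N⁺ x≁v)
      ... | yes _ | no y≁v = inj₂ (inj₁ (∈∁N⁺ y≁v))
      ... | yes x~v | yes y~v = inj₂ (inj₂ (x∈p∩q⁺ (from x∈tabulate⇔ x~v , from x∈tabulate⇔ y~v)))

      A∩B≡∅ : ∀ v → v ∈ A → v ∉ B
      A∩B≡∅ v v∈A v∈B = ∈∁N⁻ v∈B (from (twins-x v∈A y) (Adj-sym adj-x-y))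

      A∩C≡∅ : ∀ v → v ∈ A → v ∉ C
      A∩C≡∅ v v∈A v∈C = ∈∁N⁻ v∈A (proj₁ (∈C⁻ v∈C))

      B∩C≡∅ : ∀ v → v ∈ B → v ∉ C
      B∩C≡∅ v v∈B v∈C = ∈∁N⁻ v∈B (proj₂ (∈C⁻ v∈C))

      A-independent : Independent G A
      A-independent u v u∈A v∈A u~v = ∈∁N⁻ u∈A (Adj-sym (to (twins-x v∈A u) u~v))

      B-independent : Independent G B
      B-independent u v u∈B v∈B u~v = ∈∁N⁻ u∈B (Adj-sym (to (twins-y v∈B u) u~v))

      A-B∪C : ∀ a z → a ∈ A → z ∈ B ∪ C → Adj G a z
      A-B∪C a z a∈A z∈B∪C = Adj-sym (from (twins-x a∈A z) (Adj-sym x~z))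
        where
        x~z : Adj G x z
        x~z with x∈p∪q⁻ B C z∈B∪C
        ... | inj₁ z∈B = from (twins-y z∈B x) adj-x-y
        ... | inj₂ z∈C = proj₁ (∈C⁻ z∈C)

      B-C : ∀ b c → b ∈ B → c ∈ C → Adj G b c
      B-C b c b∈B c∈C = Adj-sym (from (twins-y b∈B c) (Adj-sym (proj₂ (∈C⁻ c∈C))))

    ZIrSet⇒JoinPartition : ∀ {S x y} → ZIrSet G S → (∀ z → z ∈ S ⊎ z ≡ x ⊎ z ≡ y) → JoinPartition G
    ZIrSet⇒JoinPartition {x = x} {y} ir cover =
      A , B , C , partition , A∩B≡∅ , A∩C≡∅ , B∩C≡∅ , (x , ∈∁N⁺ Adj-irrefl) , (y , ∈∁N⁺ Adj-irrefl) ,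
      A-independent , B-independent , A-B∪C , B-C
      where open JoinOfTwoOutside ir cover

    ZIrSet-size : ∀ {S} → ZIrSet G S → Fin n → 2 + ∣ S ∣ ≤ n
    ZIrSet-size ir v with ZIrSet⇒two-outside ir v
    ... | _ , _ , x≢y , x∉S , y∉S = two-outside⇒size x≢y x∉S y∉S

    ZIrSet-of-size⇒JoinPartition : ∀ {S} → ZIrSet G S → Fin n → 2 + ∣ S ∣ ≡ n → JoinPartition G
    ZIrSet-of-size⇒JoinPartition ir v size with ZIrSet⇒two-outside ir v
    ... | _ , _ , x≢y , x∉S , y∉S = ZIrSet⇒JoinPartition ir (two-outside⇒cover x≢y x∉S y∉S size)

  module FromJoin {A B C : Subset n}
    (partition : ∀ v → v ∈ A ⊎ v ∈ B ⊎ v ∈ C) (A∩B≡∅ : ∀ v → v ∈ A → v ∉ B)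
    (A-independent : Independent G A) (B-independent : Independent G B)
    (A-B∪C : ∀ a z → a ∈ A → z ∈ B ∪ C → Adj G a z) (B-C : ∀ b c → b ∈ B → c ∈ C → Adj G b c)
    {x y} (x∈A : x ∈ A) (y∈B : y ∈ B)
    where

    x≢y : x ≢ y
    x≢y refl = A∩B≡∅ x x∈A y∈B

    adj-to-A⇔ : ∀ {a w} → a ∈ A → Adj G w a ⇔ w ∉ A
    adj-to-A⇔ {a} {w} a∈A = mk⇔ (λ w~a w∈A → A-independent w a w∈A a∈A w~a) w~a
      where
      w~a : w ∉ A → Adj G w a
      w~a w∉A with partition w
      ... | inj₁ w∈A = ⊥-elim (w∉A w∈A)
      ... | inj₂ w∈B⊎C = Adj-sym (A-B∪C a w a∈A (x∈p∪q⁺ w∈B⊎C))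

    adj-to-B⇔ : ∀ {b w} → b ∈ B → Adj G w b ⇔ w ∉ B
    adj-to-B⇔ {b} {w} b∈B = mk⇔ (λ w~b w∈B → B-independent w b w∈B b∈B w~b) w~b
      where
      w~b : w ∉ B → Adj G w b
      w~b w∉B with partition w
      ... | inj₁ w∈A = A-B∪C w b w∈A (x∈p∪q⁺ (inj₁ b∈B))
      ... | inj₂ (inj₁ w∈B) = ⊥-elim (w∉B w∈B)
      ... | inj₂ (inj₂ w∈C) = Adj-sym (B-C b w b∈B w∈C)

    twins-within : ∀ {P} → (∀ {a w} → a ∈ P → Adj G w a ⇔ w ∉ P) → ∀ {a b} → a ∈ P → b ∈ P → Twins a b
    twins-within adj⇔ a∈P b∈P w = mk⇔ (from (adj⇔ b∈P) ∘ to (adj⇔ a∈P)) (from (adj⇔ a∈P) ∘ to (adj⇔ b∈P))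

    triple∩⊤-x-y⊆⁅u⁆ : ∀ {u z} → z ∈ ⊤ - x - y → z ≡ u ⊎ z ≡ x ⊎ z ≡ y → z ≡ u
    triple∩⊤-x-y⊆⁅u⁆ _ (inj₁ z≡u) = z≡u
    triple∩⊤-x-y⊆⁅u⁆ z∈S (inj₂ (inj₁ refl)) = ⊥-elim (proj₁ (∈⊤-x-y⁻ z∈S) refl)
    triple∩⊤-x-y⊆⁅u⁆ z∈S (inj₂ (inj₂ refl)) = ⊥-elim (proj₂ (∈⊤-x-y⁻ z∈S) refl)

    -- Every vertex is adjacent to at least two of u ∈ C, x ∈ A and y ∈ B.
    triple-fort : ∀ {u} → u ∈ C → u ≢ x → u ≢ y → NoUniqueNeighbour (⁅ u ⁆ ∪ ⁅ x ⁆ ∪ ⁅ y ⁆)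
    triple-fort {u} u∈C u≢x u≢y = none-or-two⇒NoUniqueNeighbour λ v → inj₂ (two v)
      where
      F : Subset n
      F = ⁅ u ⁆ ∪ ⁅ x ⁆ ∪ ⁅ y ⁆
      u∈F : u ∈ F
      u∈F = x∈p∪q⁺ (inj₁ (x∈⁅x⁆ u))
      x∈F : x ∈ F
      x∈F = x∈p∪q⁺ (inj₂ (x∈p∪q⁺ (inj₁ (x∈⁅x⁆ x))))
      y∈F : y ∈ F
      y∈F = x∈p∪q⁺ (inj₂ (x∈p∪q⁺ (inj₂ (x∈⁅x⁆ y))))
      two : ∀ v → ∃₂ λ b c → b ≢ c × b ∈ F × c ∈ F × Adj G v b × Adj G v c
      two v with partition v
      ... | inj₁ v∈A = u , y , u≢y , u∈F , y∈F ,
                       A-B∪C v u v∈A (x∈p∪q⁺ (inj₂ u∈C)) , from (adj-to-B⇔ y∈B) (A∩B≡∅ v v∈A)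
      ... | inj₂ (inj₁ v∈B) = u , x , u≢x , u∈F , x∈F ,
                       B-C v u v∈B u∈C , from (adj-to-A⇔ x∈A) (λ v∈A → A∩B≡∅ v v∈A v∈B)
      ... | inj₂ (inj₂ v∈C) = x , y , x≢y , x∈F , y∈F ,
                       Adj-sym (A-B∪C x v x∈A (x∈p∪q⁺ (inj₂ v∈C))) , Adj-sym (B-C y v y∈B v∈C)

    separating-fort : ∀ {u} → u ∈ ⊤ - x - y → ∃ (SeparatingFort (⊤ - x - y) u)
    separating-fort {u} u∈S with ∈⊤-x-y⁻ u∈S | partition u
    ... | u≢x , _ | inj₁ u∈A =
      ⁅ u ⁆ ∪ ⁅ x ⁆ ,
      twins⇒NoUniqueNeighbour u≢x (twins-within adj-to-A⇔ u∈A x∈A) ,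
      x∈p∪q⁺ (inj₁ (x∈⁅x⁆ u)) , λ z∈S → triple∩⊤-x-y⊆⁅u⁆ z∈S ∘ map₂ inj₁ ∘ ∈⁅x⁆∪⁅y⁆⁻
    ... | _ , u≢y | inj₂ (inj₁ u∈B) =
      ⁅ u ⁆ ∪ ⁅ y ⁆ ,
      twins⇒NoUniqueNeighbour u≢y (twins-within adj-to-B⇔ u∈B y∈B) ,
      x∈p∪q⁺ (inj₁ (x∈⁅x⁆ u)) , λ z∈S → triple∩⊤-x-y⊆⁅u⁆ z∈S ∘ map₂ inj₂ ∘ ∈⁅x⁆∪⁅y⁆⁻
    ... | u≢x , u≢y | inj₂ (inj₂ u∈C) =
      ⁅ u ⁆ ∪ ⁅ x ⁆ ∪ ⁅ y ⁆ , triple-fort u∈C u≢x u≢y , x∈p∪q⁺ (inj₁ (x∈⁅x⁆ u)) ,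
      λ z∈S → triple∩⊤-x-y⊆⁅u⁆ z∈S ∘ Sum.map (x∈⁅y⁆⇒x≡y u) ∈⁅x⁆∪⁅y⁆⁻ ∘ x∈p∪q⁻ ⁅ u ⁆ _

  JoinPartition⇒forcing-ZIrSet :
    JoinPartition G → ∃[ S ] ZIrSet G S × SkewForcingSet G S × 2 + ∣ S ∣ ≡ n
  JoinPartition⇒forcing-ZIrSet
    (A , B , C , partition , A∩B≡∅ , _ , _ , (x , x∈A) , (y , y∈B) , A-indep , B-indep , A-B∪C , B-C) =
    ⊤ - x - y , from ZIrSet⇔ separating-fort , edge-cover⇒forcing x~y cover , size
    where
    open FromJoin partition A∩B≡∅ A-indep B-indep A-B∪C B-C x∈A y∈B
    x~y : Adj G x y
    x~y = A-B∪C x y x∈A (x∈p∪q⁺ (inj₁ y∈B))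
    size : 2 + ∣ ⊤ - x - y ∣ ≡ n
    size = ∣⊤-x-y∣ (x≢y ∘ sym)
    cover : ∀ z → z ∈ ⊤ - x - y ⊎ z ≡ x ⊎ z ≡ y
    cover = two-outside⇒cover x≢y (λ x∈ → proj₁ (∈⊤-x-y⁻ x∈) refl) (λ y∈ → proj₂ (∈⊤-x-y⁻ y∈) refl) size

theorem3p41 : (n : ℕ) → 2 ≤ n → (G : Graph n) → Connected G →
    (ZbarMinus≡ G (n ∸ 2) ⇔ ZIR≡ G (n ∸ 2)) × (ZIR≡ G (n ∸ 2) ⇔ JoinPartition G)
theorem3p41 (suc zero) (s≤s ()) _ _
theorem3p41 (suc (suc m)) _ G connected = mk⇔ Zbar⇒ZIR ZIR⇒Zbar , mk⇔ ZIR⇒join join⇒ZIR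
  where
  no-isolated : ∀ x → ∃ (Adj G x)
  no-isolated x = walk⇒edge G (connected x (punchIn x zero)) (punchInᵢ≢i x zero ∘ sym)

  ZIrSet-bound : ∀ S → ZIrSet G S → ∣ S ∣ ≤ m
  ZIrSet-bound S ir = s≤s⁻¹ (s≤s⁻¹ (ZIrSet-size G no-isolated ir zero))

  Zbar⇒ZIR : ZbarMinus≡ G m → ZIR≡ G m
  Zbar⇒ZIR ((S , minimal , ∣S∣≡m) , _) = (S , minimal⇒ZIrSet G minimal , ∣S∣≡m) , ZIrSet-bound

  ZIR⇒join : ZIR≡ G m → JoinPartition G
  ZIR⇒join ((S , ir , ∣S∣≡m) , _) =
    ZIrSet-of-size⇒JoinPartition G no-isolated ir zero (cong (2 +_) ∣S∣≡m)

  ForcingZIrSet : Set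
  ForcingZIrSet = ∃[ S ] ZIrSet G S × SkewForcingSet G S × 2 + ∣ S ∣ ≡ 2 + m

  ZIR-of : ForcingZIrSet → ZIR≡ G m
  ZIR-of (S , ir , _ , size) = (S , ir , suc-injective (suc-injective size)) , ZIrSet-bound

  Zbar-of : ForcingZIrSet → ZbarMinus≡ G m
  Zbar-of (S , ir , forcing , size) =
    (S , forcing-ZIrSet⇒minimal G forcing ir , suc-injective (suc-injective size)) ,
    λ S minimal → ZIrSet-bound S (minimal⇒ZIrSet G minimal)

  join⇒ZIR : JoinPartition G → ZIR≡ G m
  join⇒ZIR = ZIR-of ∘ JoinPartition⇒forcing-ZIrSet G

  ZIR⇒Zbar : ZIR≡ G m → ZbarMinus≡ G m
  ZIR⇒Zbar = Zbar-of ∘ JoinPartition⇒forcing-ZIrSet G ∘ ZIR⇒join
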